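{- Let $\mathbf{C}$ be a small category, $\widehat{\mathbf{C}}=\mathbf{Sets}^{\mathbf{C}^{op}}$, and $\Omega_*$ the presheaf with $\Omega_*(C)$ the set of all sets of arrows of $\mathbf{C}$ with codomain $C$ and $\Omega_*(g)(s)=\{h\mid g\circ h\in s\}$ for $g:D\to C$. For $\varphi:M\to\Omega_*$ in $\widehat{\mathbf{C}}$, $C\in\mathbf{C}$ and $a\in M(C)$ write $C\Vdash_*\varphi(a)$ iff $1_C\in\varphi_C(a)$. Then for all $\varphi,\psi:M\to\Omega_*$, objects $C$ and $a\in M(C)$: (1) $C\Vdash_*\top(a)$ always and $C\Vdash_*\bot(a)$ never (for the constant maps $M\to\Omega_*$ at the top and bottom elements); (2) $C\Vdash_*(\varphi\wedge\psi)(a)$ iff $C\Vdash_*\varphi(a)$ and $C\Vdash_*\psi(a)$; (3) $C\Vdash_*(\varphi\vee\psi)(a)$ iff $C\Vdash_*\varphi(a)$ or $C\Vdash_*\psi(a)$; (4) $C\Vdash_*(\varphi\Rightarrow\psi)(a)$ iff $C\Vdash_*\varphi(a)$ implies $C\Vdash_*\psi(a)$; (5) for $\varphi:M\times M\to\Omega_*$ with exponential transpose (in the second variable) $\widehat\varphi:M\to\Omega_*^M$: $C\Vdash_*(\forall_M\circ\widehat\varphi)(a)$ iff $C\Vdash_*\varphi(a,b)$ for all $b\in M(C)$, and $C\Vdash_*(\exists_M\circ\widehat\varphi)(a)$ iff $C\Vdash_*\varphi(a,b)$ for some $b\in M(C)$; (6) $C\Vdash_*(i\tau\circ\varphi)(a)$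 iff $D\Vdash_*\varphi(M(p)(a))$ for every arrow $p:D\to C$; (7) for $t:M\to N$ and $u:M\to\Omega_*^N$, writing $\mathrm{ev}:\Omega_*^N\times N\to\Omega_*$ for evaluation: $C\Vdash_*(\mathrm{ev}\circ\langle u,t\rangle)(a)$ iff $1_C\in (u_C(a))_C(1_C,t_C(a))$.
   Context: $\Omega_*$ is (up to isomorphism) $f_*\Omega$ for the geometric morphism $f:\mathbf{Sets}^{|\mathbf{C}|}\to\widehat{\mathbf{C}}$ induced by the inclusion of the discrete category $|\mathbf{C}|$ of objects into $\mathbf{C}$ ($f^*$ is restriction, $f_*$ right Kan extension); the condition $1_C\in\varphi_C(a)$ is equivalent to $a$ lying in the subfamily of $f^*M$ classified in $\mathbf{Sets}^{|\mathbf{C}|}$ by the transpose of $\varphi$ along $f^*\dashv f_*$. $\Omega_*$ is an internal complete Heyting algebra whose finite operations $\wedge,\vee,\Rightarrow,\top,\bot$ are computed pointwise (intersection, union, relative complement-implication, all arrows, empty set in each $\Omega_*(C)$); $(\varphi\star\psi)$ denotes $\star\circ\langle\varphi,\psi\rangle$. Exponentials: $\Omega_*^M(C)=\mathrm{Hom}(\mathbf{y}C\times M,\Omega_*)$, $\mathbf{y}C=\mathrm{Hom}_{\mathbf{C}}(-,C)$, and $\widehat\varphi_C(a)_D(g,b)=\varphi_D(M(g)(a),b)$; evaluation is $\mathrm{ev}_C(\eta,b)=\eta_C(1_C,b)$. $\forall_M,\exists_M:\Omega_*^M\to\Omega_*$ are the internal right and left adjoints of the diagonal $\Omega_*\to\Omega_*^M$;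 explicitly $\forall_M$ at $C$ sends $\eta$ to $\bigcup\{s\in\Omega_*(C)\mid \Omega_*(g)(s)\subseteq\eta_D(g,b)\ \forall g:D\to C,\ b\in M(D)\}$ and $\exists_M$ sends $\eta$ to $\bigcap\{s\mid \eta_D(g,b)\subseteq\Omega_*(g)(s)\ \forall g,b\}$. $\Omega$ is the subobject classifier of $\widehat{\mathbf{C}}$ (sieves), $i:\Omega\to\Omega_*$ is the inclusion of sieves, and $\tau:\Omega_*\to\Omega$ sends a set of arrows into $C$ to the largest sieve on $C$ contained in it. -}

module Defs where

open import Level using (Level; _⊔_) renaming (suc to lsuc)
open import Relation.Binary.PropositionalEquality using (_≡_; refl; subst; sym)
open import Data.Product using (Σ; _×_; _,_; proj₁; proj₂)
open import Data.Sum using (_⊎_; inj₁; inj₂)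
open import Function.Bundles using (_⇔_; mk⇔; Equivalence)
import Data.Unit.Polymorphic as U
import Data.Empty.Polymorphic as E

record Category : Set₁ where
  infixr 9 _∘_
  field
    Obj : Set
    Hom : Obj → Obj → Set
    id  : ∀ {A} → Hom A A
    _∘_ : ∀ {A B C} → Hom B C → Hom A B → Hom A C
    identityˡ : ∀ {A B} (f : Hom A B) → id ∘ f ≡ f
    identityʳ : ∀ {A B} (f : Hom A B) → f ∘ id ≡ f
    assoc : ∀ {A B C D} (f : Hom C D) (g : Hom B C) (h : Hom A B) →
            (f ∘ g) ∘ h ≡ f ∘ (g ∘ h)

module Over (𝐂 : Category) where
  open Category 𝐂

  record Presheaf : Set₁ where
    field
      F₀ : Obj → Set
      F₁ : ∀ {C D} → Hom D C → F₀ C → F₀ D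
      F-id : ∀ {C} (a : F₀ C) → F₁ id a ≡ a
      F-∘ : ∀ {C D E} (g : Hom D C) (h : Hom E D) (a : F₀ C) →
            F₁ (g ∘ h) a ≡ F₁ h (F₁ g a)
  open Presheaf

  record NatTrans (M N : Presheaf) : Set where
    field
      η : ∀ {C} → F₀ M C → F₀ N C
      natural : ∀ {C D} (g : Hom D C) (a : F₀ M C) → η (F₁ M g a) ≡ F₁ N g (η a)

  _×P_ : Presheaf → Presheaf → Presheaf
  F₀ (M ×P N) C = F₀ M C × F₀ N C
  F₁ (M ×P N) g p = F₁ M g (proj₁ p) , F₁ N g (proj₂ p)
  F-id (M ×P N) (a , b) rewrite F-id M a | F-id N b = refl
  F-∘ (M ×P N) g h (a , b) rewrite F-∘ M g h a | F-∘ N g h b = refl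

  -- Ω_*(C): (ℓ-small) sets of arrows with codomain C, as predicates
  ArrowSet : (ℓ : Level) → Obj → Set (lsuc ℓ)
  ArrowSet ℓ C = ∀ {D} → Hom D C → Set ℓ

  restrict : ∀ {ℓ C D} → Hom D C → ArrowSet ℓ C → ArrowSet ℓ D
  restrict g s h = s (g ∘ h)

  _⊆_ : ∀ {ℓ ℓ' C} → ArrowSet ℓ C → ArrowSet ℓ' C → Set (ℓ ⊔ ℓ')
  s ⊆ t = ∀ {D} (h : Hom D _) → s h → t h

  _≐_ : ∀ {ℓ C} → ArrowSet ℓ C → ArrowSet ℓ C → Set ℓ
  s ≐ t = ∀ {D} (h : Hom D _) → s h ⇔ t h

  ⊤A : ∀ {ℓ C} → ArrowSet ℓ C
  ⊤A h = U.⊤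
  ⊥A : ∀ {ℓ C} → ArrowSet ℓ C
  ⊥A h = E.⊥
  _∩_ : ∀ {ℓ C} → ArrowSet ℓ C → ArrowSet ℓ C → ArrowSet ℓ C
  (s ∩ t) h = s h × t h
  _∪_ : ∀ {ℓ C} → ArrowSet ℓ C → ArrowSet ℓ C → ArrowSet ℓ C
  (s ∪ t) h = s h ⊎ t h
  _⇒_ : ∀ {ℓ C} → ArrowSet ℓ C → ArrowSet ℓ C → ArrowSet ℓ C
  (s ⇒ t) h = s h → t h

  record ToΩ* (M : Presheaf) (ℓ : Level) : Set (lsuc ℓ) where
    field
      comp : ∀ {C} → F₀ M C → ArrowSet ℓ C
      natural : ∀ {C D} (g : Hom D C) (a : F₀ M C) →
                comp (F₁ M g a) ≐ restrict g (comp a)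
  open ToΩ* public

  ⊤M : ∀ {ℓ} (M : Presheaf) → ToΩ* M ℓ
  comp (⊤M M) a = ⊤A
  natural (⊤M M) g a h = mk⇔ (λ x → x) (λ x → x)

  ⊥M : ∀ {ℓ} (M : Presheaf) → ToΩ* M ℓ
  comp (⊥M M) a = ⊥A
  natural (⊥M M) g a h = mk⇔ (λ x → x) (λ x → x)

  private
    to : ∀ {a b} {A : Set a} {B : Set b} → A ⇔ B → A → B
    to = Equivalence.to
    from : ∀ {a b} {A : Set a} {B : Set b} → A ⇔ B → B → A
    from = Equivalence.from

  _∧M_ : ∀ {ℓ M} → ToΩ* M ℓ → ToΩ* M ℓ → ToΩ* M ℓ
  comp (φ ∧M ψ) a = comp φ a ∩ comp ψ a
  natural (φ ∧M ψ) g a h =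
    mk⇔ (λ p → to (natural φ g a h) (proj₁ p) , to (natural ψ g a h) (proj₂ p))
        (λ p → from (natural φ g a h) (proj₁ p) , from (natural ψ g a h) (proj₂ p))

  _∨M_ : ∀ {ℓ M} → ToΩ* M ℓ → ToΩ* M ℓ → ToΩ* M ℓ
  comp (φ ∨M ψ) a = comp φ a ∪ comp ψ a
  natural (φ ∨M ψ) g a h =
    mk⇔ (λ { (inj₁ x) → inj₁ (to (natural φ g a h) x)
           ; (inj₂ y) → inj₂ (to (natural ψ g a h) y) })
        (λ { (inj₁ x) → inj₁ (from (natural φ g a h) x)
           ; (inj₂ y) → inj₂ (from (natural ψ g a h) y) })

  _⇒M_ : ∀ {ℓ M} → ToΩ* M ℓ → ToΩ* M ℓ → ToΩ* M ℓ
  comp (φ ⇒M ψ) a = comp φ a ⇒ comp ψ a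
  natural (φ ⇒M ψ) g a h =
    mk⇔ (λ f x → to (natural ψ g a h) (f (from (natural φ g a h) x)))
        (λ f x → from (natural ψ g a h) (f (to (natural φ g a h) x)))

  -- Elements of Ω_*^N(C) = Hom(yC × N, Ω_*)
  record ExpΩ* (N : Presheaf) (ℓ : Level) (C : Obj) : Set (lsuc ℓ) where
    field
      at : ∀ {D} → Hom D C → F₀ N D → ArrowSet ℓ D
      natural : ∀ {D E} (g : Hom D C) (k : Hom E D) (b : F₀ N D) →
                at (g ∘ k) (F₁ N k b) ≐ restrict k (at g b)
  open ExpΩ* public

  _≈E_ : ∀ {N ℓ C} → ExpΩ* N ℓ C → ExpΩ* N ℓ C → Set ℓ
  _≈E_ {N} e e' = ∀ {D} (g : Hom D _) (b : F₀ N D) → at e g b ≐ at e' g b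

  restrictE : ∀ {N ℓ C D} → Hom D C → ExpΩ* N ℓ C → ExpΩ* N ℓ D
  at (restrictE g e) k b = at e (g ∘ k) b
  natural (restrictE {N} g e) k m b =
    subst (λ x → at e x (F₁ N m b) ≐ restrict m (at e (g ∘ k) b))
          (assoc g k m) (natural e (g ∘ k) m b)

  record ToExp (M N : Presheaf) (ℓ : Level) : Set (lsuc ℓ) where
    field
      compE : ∀ {C} → F₀ M C → ExpΩ* N ℓ C
      naturalE : ∀ {C D} (g : Hom D C) (a : F₀ M C) →
                 compE (F₁ M g a) ≈E restrictE g (compE a)
  open ToExp public

  ev : ∀ {ℓ C} (N : Presheaf) → ExpΩ* N ℓ C → F₀ N C → ArrowSet ℓ C
  ev N e b = at e id b

  hat : ∀ {ℓ} {M : Presheaf} → ToΩ* (M ×P M) ℓ → ∀ {C} → F₀ M C → ExpΩ* M ℓ C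
  at (hat {M = M} φ a) g b = comp φ (F₁ M g a , b)
  natural (hat {M = M} φ a) g k b =
    subst (λ x → comp φ (x , F₁ M k b) ≐ restrict k (comp φ (F₁ M g a , b)))
          (sym (F-∘ M g k a)) (natural φ k (F₁ M g a , b))

  -- ∀_M, ∃_M : Ω_*^M → Ω_*, component at C (union / intersection formulas)
  ∀M : ∀ {ℓ C} (M : Presheaf) → ExpΩ* M ℓ C → ArrowSet (lsuc ℓ) C
  ∀M {ℓ} {C} M e h =
    Σ (ArrowSet ℓ C) λ s →
      (∀ {D} (g : Hom D C) (b : F₀ M D) → restrict g s ⊆ at e g b) × s h

  ∃M : ∀ {ℓ C} (M : Presheaf) → ExpΩ* M ℓ C → ArrowSet (lsuc ℓ) C
  ∃M {ℓ} {C} M e h =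
    (s : ArrowSet ℓ C) →
      (∀ {D} (g : Hom D C) (b : F₀ M D) → at e g b ⊆ restrict g s) → s h

  -- sieves, and i ∘ τ : Ω_* → Ω → Ω_* (largest sieve contained in s)
  IsSieve : ∀ {ℓ C} → ArrowSet ℓ C → Set ℓ
  IsSieve {C = C} S = ∀ {D E} (f : Hom D C) (k : Hom E D) → S f → S (f ∘ k)

  iτ : ∀ {ℓ C} → ArrowSet ℓ C → ArrowSet (lsuc ℓ) C
  iτ {ℓ} {C} s h = Σ (ArrowSet ℓ C) λ S → IsSieve S × (S ⊆ s) × S h

  Forces : ∀ {ℓ} (C : Obj) → ArrowSet ℓ C → Set ℓ
  Forces C s = s (id {C})

module Submission where

-- Clauses (1)-(4) and (7) hold by definition: the
-- Heyting operations of Ω_* and evaluation are computed pointwise, so the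
-- forcing condition for a compound is literally the compound of the forcing
-- conditions.  The content lies in the quantifier clauses (5) and (6), which
-- rest on a Yoneda-style fact: if t is the restriction of s along p : D → C
-- then D ⊩* t iff p ∈ s (`forces-restrict`).  Naturality of φ : M → Ω_* thus
-- says p ∈ φ_C(a) iff D ⊩* φ(M(p)(a)), and likewise for elements of Ω_*^M.
--
-- From this we compute forcing of the three "quantifier-like" operators on an
-- arbitrary argument: iτ(s) is forced iff s contains every arrow into C
-- (`forces-iτ`); ∀_M(η) resp. ∃_M(η) is forced iff ev(η, b) is forced for all
-- resp. some b ∈ M(C) (`forces-∀M`, `forces-∃M`).  Specialising η to the
-- transpose φ̂(a), whose evaluation at b is φ(a, b) (`forces-ev-hat`), gives (5);
-- specialising s to φ_C(a) gives (6).

open import Defs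
open import Level using (Level)
open import Data.Product using (Σ; _×_; _,_)
open import Data.Sum using (_⊎_)
open import Function.Bundles using (_⇔_; mk⇔; Equivalence)
open import Function.Construct.Identity using (⇔-id)
open import Function.Construct.Composition using (_⇔-∘_)
open import Relation.Nullary using (¬_)
open import Relation.Binary.PropositionalEquality using (_≡_; refl; cong)

open Equivalence using (to; from)

≡⇒⇔ : ∀ {a} {A B : Set a} → A ≡ B → A ⇔ B
≡⇒⇔ {A = A} refl = ⇔-id A

module Forcing {ℓ : Level} (𝐂 : Category) where
  open Category 𝐂
  open Over 𝐂
  open Presheaf

  forces-restrict : ∀ {C D} (s : ArrowSet ℓ C) {t : ArrowSet ℓ D} (p : Hom D C) →
                    t ≐ restrict p s → Forces D t ⇔ s p
  forces-restrict s p t≐ps = ≡⇒⇔ (cong (λ f → s f) (identityʳ p)) ⇔-∘ t≐ps id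

  -- The largest sieve inside s contains 1_C iff s contains every arrow into C:
  -- a sieve containing 1_C is maximal, and the maximal sieve is a sieve.
  forces-iτ : ∀ {C} (s : ArrowSet ℓ C) →
              Forces C (iτ s) ⇔ (∀ {D} (p : Hom D C) → s p)
  forces-iτ s = mk⇔ maximal (λ all → ⊤A , (λ _ _ _ → _) , (λ h _ → all h) , _)
    where
    maximal : Forces _ (iτ s) → ∀ {D} (p : Hom D _) → s p
    maximal (S , isSieve , S⊆s , S1) p =
      S⊆s p (to (≡⇒⇔ (cong (λ f → S f) (identityˡ p))) (isSieve id p S1))

  -- For the
  -- converse, the witness s is the set of h : D → C with η_D(h, b) forced for
  -- all b ∈ M(D); naturality of η shows every restriction of s lies below η.
  forces-∀M : ∀ {C} (M : Presheaf) (η : ExpΩ* M ℓ C) →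
              Forces C (∀M M η) ⇔ (∀ (b : F₀ M C) → Forces C (ev M η b))
  forces-∀M {C} M η = mk⇔ instantiate (λ all → s , bounded , all)
    where
    instantiate : Forces C (∀M M η) → ∀ b → Forces C (ev M η b)
    instantiate (s , bounded , s1) b =
      bounded id b id (from (≡⇒⇔ (cong (λ f → s f) (identityˡ id))) s1)
    s : ArrowSet ℓ C
    s {D} h = ∀ (b : F₀ M D) → Forces D (at η h b)
    bounded : ∀ {D} (g : Hom D C) (b : F₀ M D) → restrict g s ⊆ at η g b
    bounded g b h s-gh = to (forces-restrict (at η g b) h (natural η g h b)) (s-gh (F₁ M h b))

  -- Forwards, apply the defining intersection to the set of h : D → C with
  -- η_D(h, b) forced for some b ∈ M(D), which bounds every value of η.
  forces-∃M : ∀ {C} (M : Presheaf) (η : ExpΩ* M ℓ C) →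
              Forces C (∃M M η) ⇔ Σ (F₀ M C) (λ b → Forces C (ev M η b))
  forces-∃M {C} M η = mk⇔ (λ forced → forced s bounds) witness
    where
    s : ArrowSet ℓ C
    s {D} h = Σ (F₀ M D) λ b → Forces D (at η h b)
    bounds : ∀ {D} (g : Hom D C) (b : F₀ M D) → at η g b ⊆ restrict g s
    bounds g b h x = F₁ M h b , from (forces-restrict (at η g b) h (natural η g h b)) x
    witness : Σ (F₀ M C) (λ b → Forces C (ev M η b)) → Forces C (∃M M η)
    witness (b , forced) t bound =
      to (≡⇒⇔ (cong (λ f → t f) (identityˡ id))) (bound id b id forced)

  forces-ev-hat : ∀ {C} (M : Presheaf) (φ : ToΩ* (M ×P M) ℓ) (a b : F₀ M C) →
                  Forces C (ev M (hat φ a) b) ⇔ Forces C (comp φ (a , b))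
  forces-ev-hat {C} M φ a b =
    ≡⇒⇔ (cong (λ x → Forces C (comp {M = M ×P M} φ (x , b))) (F-id M a))

  forces-∀-hat : ∀ {C} (M : Presheaf) (φ : ToΩ* (M ×P M) ℓ) (a : F₀ M C) →
                 Forces C (∀M M (hat φ a)) ⇔ (∀ (b : F₀ M C) → Forces C (comp φ (a , b)))
  forces-∀-hat M φ a = mk⇔
    (λ forced b → to (forces-ev-hat M φ a b) (to (forces-∀M M (hat φ a)) forced b))
    (λ all → from (forces-∀M M (hat φ a)) (λ b → from (forces-ev-hat M φ a b) (all b)))

  forces-∃-hat : ∀ {C} (M : Presheaf) (φ : ToΩ* (M ×P M) ℓ) (a : F₀ M C) →
                 Forces C (∃M M (hat φ a)) ⇔ Σ (F₀ M C) (λ b → Forces C (comp φ (a , b)))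
  forces-∃-hat M φ a = mk⇔
    (λ forced → let (b , fb) = to (forces-∃M M (hat φ a)) forced
                in b , to (forces-ev-hat M φ a b) fb)
    (λ (b , fb) → from (forces-∃M M (hat φ a)) (b , from (forces-ev-hat M φ a b) fb))

  forces-iτ∘ : ∀ {C} (M : Presheaf) (φ : ToΩ* M ℓ) (a : F₀ M C) →
               Forces C (iτ (comp φ a)) ⇔ (∀ {D} (p : Hom D C) → Forces D (comp φ (F₁ M p a)))
  forces-iτ∘ M φ a = mk⇔
    (λ forced {_} p → from (membership p) (to (forces-iτ (comp φ a)) forced p))
    (λ all → from (forces-iτ (comp φ a)) (λ p → to (membership p) (all p)))
    where
    membership : ∀ {D} (p : Hom D _) → Forces D (comp φ (F₁ M p a)) ⇔ comp φ a p
    membership p = forces-restrict (comp φ a) p (ToΩ*.natural φ p a)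

mainTheorem12 : ∀ {ℓ : Level} (𝐂 : Category) →
    let open Category 𝐂
        open Over 𝐂
        open Presheaf
    in (M : Presheaf) →
       (∀ (φ ψ : ToΩ* M ℓ) (C : Obj) (a : F₀ M C) →
            Forces C (comp (⊤M {ℓ} M) a)
          × ¬ Forces C (comp (⊥M {ℓ} M) a)
          × (Forces C (comp (φ ∧M ψ) a) ⇔ (Forces C (comp φ a) × Forces C (comp ψ a)))
          × (Forces C (comp (φ ∨M ψ) a) ⇔ (Forces C (comp φ a) ⊎ Forces C (comp ψ a)))
          × (Forces C (comp (φ ⇒M ψ) a) ⇔ (Forces C (comp φ a) → Forces C (comp ψ a)))
          × (Forces C (iτ (comp φ a))
               ⇔ (∀ {D : Obj} (p : Hom D C) → Forces D (comp φ (F₁ M p a)))))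
     × (∀ (φ : ToΩ* (M ×P M) ℓ) (C : Obj) (a : F₀ M C) →
            (Forces C (∀M M (hat φ a)) ⇔ (∀ (b : F₀ M C) → Forces C (comp φ (a , b))))
          × (Forces C (∃M M (hat φ a)) ⇔ Σ (F₀ M C) (λ b → Forces C (comp φ (a , b)))))
     × (∀ (N : Presheaf) (t : NatTrans M N) (u : ToExp M N ℓ) (C : Obj) (a : F₀ M C) →
            Forces C (ev N (compE u a) (NatTrans.η t a))
              ⇔ at (compE u a) id (NatTrans.η t a) id)
mainTheorem12 𝐂 M =
  (λ φ ψ C a → _ , (λ ()) , ⇔-id _ , ⇔-id _ , ⇔-id _ , forces-iτ∘ M φ a)
  , (λ φ C a → forces-∀-hat M φ a , forces-∃-hat M φ a)
  , (λ N t u C a → ⇔-id _)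
  where open Forcing 𝐂
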